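{- Let $\psi_{n,k} := |\{ w\in X_n \mid \operatorname{basc}(w) = k\}|$ for $n\ge1$ and integers $k$. Then $\psi_{1,0} = 1$, $\psi_{1,k} = 0$ for $k\neq0$, and for all $n>1$ and all integers $k$, \[ \psi_{n,k} = (2n-2k+1)\,\psi_{n-1,k-1} + (2k+1)\,\psi_{n-1,k}. \] In particular, the numbers $\psi_{n,k}$ are completely determined by this recurrence and these initial conditions.
   Context: $\mathfrak{B}_n$ is the group of bijections $w$ of $[\![n]\!] := \{ -n,\dots,-1,1,\dots,n\}$ with $w(-i)=-w(i)$; $\bar i := -i$, $w_i := w(i)$. $X_n := \{w \in \mathfrak{B}_n \mid w^{ -1}(1) > 0\}$. Order $[\![n]\!]$ by $\bar n < \dots < \bar 1 < 1 < \dots < n$; write $a \ll b$ if some $c \in [\![n]\!]$ satisfies $a<c<b$. $w$ has a big ascent at $\bar1$ iff $w_1 \ge 2$; at $i\in\{1,\dots,n-1\}$ iff $w_i \ll w_{i+1}$; at $n$ iff $w_n \le \bar 2$; $\operatorname{basc}(w)$ is the number of big ascents. -}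

module Defs where

open import Data.Bool using (Bool; true; false; _∧_; not; if_then_else_)
open import Data.Nat as ℕ using (ℕ; zero; suc)
open import Data.Integer using (ℤ; +_; -[1+_]; -_; 1ℤ; _<?_; _≤?_)
open import Data.Integer.Properties using (_≟_)
open import Data.List using (List; []; _∷_; map; _++_; upTo; concatMap; filter; length)
open import Data.Bool.ListAction using (any; all)
open import Data.Bool.Properties using () renaming (_≟_ to _≟ᵇ_)
open import Data.Vec using (Vec; toList) renaming ([] to []ᵥ; _∷_ to _∷ᵥ_)
open import Relation.Nullary using (does)

-- An element w of 𝔅_n is represented by its window
-- (w_1, …, w_n) : Vec ℤ n, the values in [[n]] being encoded as the
-- nonzero integers -n,…,-1,1,…,n.  The whole map on [[n]] is then
-- w(i) = w_i and w(-i) = -w_i (see `ext`), so w(-i) = -w(i) holds by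
-- construction; `isBn` checks that this map is a bijection of [[n]].

infix 4 _==_ _<ᵇ_ _≤ᵇ_

_==_ : ℤ → ℤ → Bool
x == y = does (x ≟ y)

_<ᵇ_ : ℤ → ℤ → Bool
x <ᵇ y = does (x <? y)

_≤ᵇ_ : ℤ → ℤ → Bool
x ≤ᵇ y = does (x ≤? y)

positives : ℕ → List ℤ
positives n = map (λ i → + suc i) (upTo n)

signedRange : ℕ → List ℤ
signedRange n = map -_ (positives n) ++ positives n

allVecs : List ℤ → (n : ℕ) → List (Vec ℤ n)
allVecs A zero    = []ᵥ ∷ []
allVecs A (suc n) = concatMap (λ x → map (x ∷ᵥ_) (allVecs A n)) A

nth : List ℤ → ℕ → ℤ
nth []       _       = + 0
nth (x ∷ xs) zero    = x
nth (x ∷ xs) (suc i) = nth xs i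

ext : {n : ℕ} → Vec ℤ n → ℤ → ℤ
ext w (+ zero)  = + 0
ext w (+ suc i) = nth (toList w) i
ext w -[1+ i ]  = - nth (toList w) i

member : ℤ → List ℤ → Bool
member x ys = any (x ==_) ys

noDup : List ℤ → Bool
noDup []       = true
noDup (x ∷ xs) = not (member x xs) ∧ noDup xs

-- w ∈ 𝔅_n : the map i ↦ w(i) sends [[n]] injectively into [[n]]
-- (hence is a bijection of the finite set [[n]])
isBn : (n : ℕ) → Vec ℤ n → Bool
isBn n w = all (λ y → member y (signedRange n)) images ∧ noDup images
  where images = map (ext w) (signedRange n)

-- w ∈ X_n : w ∈ 𝔅_n and w⁻¹(1) > 0, i.e. 1 = w(i) for some positive i
inX : (n : ℕ) → Vec ℤ n → Bool
inX n w = isBn n w ∧ any (λ i → ext w i == 1ℤ) (positives n)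

_≪[_]_ : ℤ → ℕ → ℤ → Bool
a ≪[ n ] b = any (λ c → (a <ᵇ c) ∧ (c <ᵇ b)) (signedRange n)

indicator : Bool → ℕ
indicator true  = 1
indicator false = 0

ascFirst : List ℤ → ℕ
ascFirst []      = 0
ascFirst (x ∷ _) = indicator (+ 2 ≤ᵇ x)

ascMiddle : ℕ → List ℤ → ℕ
ascMiddle n []           = 0
ascMiddle n (x ∷ [])     = 0
ascMiddle n (x ∷ y ∷ xs) = indicator (x ≪[ n ] y) ℕ.+ ascMiddle n (y ∷ xs)

ascLast : List ℤ → ℕ
ascLast []           = 0
ascLast (x ∷ [])     = indicator (x ≤ᵇ -[1+ 1 ])
ascLast (x ∷ y ∷ xs) = ascLast (y ∷ xs)

basc : (n : ℕ) → Vec ℤ n → ℕ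
basc n w = ascFirst (toList w) ℕ.+ ascMiddle n (toList w) ℕ.+ ascLast (toList w)

ψ : ℕ → ℤ → ℕ
ψ n k = length (filter (λ w → (inX n w ∧ ((+ basc n w) == k)) ≟ᵇ true) (allVecs (signedRange n) n))

module Submission where

-- Removing ±n from the window of w ∈ X_n (n ≥ 2) leaves the window of an element of X_(n-1);
-- conversely every w′ ∈ X_(n-1) has exactly 2n extensions in X_n, obtained by inserting n or n̄
-- into one of the n slots of its window.  Padding windows by w(0) = w(n+1) = 0 turns every big
-- ascent into a gap test a ≪ b between neighbours.  Inserting n (resp. n̄) between neighbours
-- a, b replaces the test a ≪ b by a ≪ n (resp. n̄ ≪ b), so it adds one big ascent or none; none
-- exactly when a ≪ b held already (2 basc(w′) insertions) or a = n-1 (resp. b = -(n-1)), and by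
-- pigeonhole w′ contains exactly one of ±(n-1).  So 2 basc(w′) + 1 extensions of w′ keep its
-- number of big ascents and the other 2n - 2 basc(w′) - 1 raise it by one.

open import Defs
open import Data.Bool using (Bool; true; false; T; _∧_; not)
open import Data.Bool.Properties using (T-≡; T-∧; ¬-not) renaming (_≟_ to _≟ᵇ_)
open import Data.Bool.ListAction using (any; all; or)
open import Data.Nat using (ℕ; zero; suc; _≤_; _∸_; z≤n; s≤s)
import Data.Nat as ℕ
import Data.Nat.Properties as ℕ
open import Data.Nat.ListAction using (sum)
open import Algebra.Properties.CommutativeSemigroup ℕ.+-commutativeSemigroup using (x∙yz≈y∙xz)
open import Data.Integer as ℤ using (ℤ; +_; -[1+_]; -_; _+_; _-_; _*_; 0ℤ; 1ℤ)
import Data.Integer.Properties as ℤ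
open import Data.List using (List; []; _∷_; [_]; _++_; map; concatMap; filter; length; upTo; applyUpTo)
import Data.List.Properties as List
open import Data.List.Relation.Unary.Any as Any using (Any; here; there)
open import Data.List.Relation.Unary.Any.Properties using (any⁺; any⁻)
open import Data.List.Relation.Unary.All as All using (All; []; _∷_)
open import Data.List.Relation.Unary.All.Properties using (all⁺; all⁻; All¬⇒¬Any; ¬Any⇒All¬) renaming (++⁺ to All-++⁺)
open import Data.List.Relation.Unary.AllPairs as AllPairs using (AllPairs; []; _∷_)
import Data.List.Relation.Unary.AllPairs.Properties as AllPairs
open import Data.List.Relation.Binary.Disjoint.Propositional using (Disjoint)
open import Data.List.Relation.Unary.Unique.Propositional using (Unique)
import Data.List.Relation.Unary.Unique.Propositional.Properties as Unique
open import Data.List.Relation.Binary.Subset.Propositional using (_⊆_)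
open import Data.List.Membership.Propositional using (_∈_; _∉_; find; lose)
open import Data.List.Membership.DecPropositional ℤ._≟_ using (_∈?_)
open import Data.List.Membership.Propositional.Properties
  using (∈-map⁺; ∈-map⁻; ∈-++⁺ˡ; ∈-++⁺ʳ; ∈-++⁻; ∈-upTo⁺; ∈-upTo⁻; ∈-filter⁺; ∈-filter⁻; ∈-concatMap⁺; ∈-concatMap⁻)
open import Data.Vec using (Vec; toList) renaming ([] to []ᵥ; _∷_ to _∷ᵥ_)
open import Data.Product using (∃; _×_; _,_; proj₁; proj₂)
open import Data.Sum using (_⊎_; inj₁; inj₂)
open import Data.Empty using (⊥; ⊥-elim)
open import Function using (_∘_; id; Equivalence; _⟨_⟩_)
open import Relation.Nullary using (Dec; yes; no; does)
open import Relation.Nullary.Decidable using (dec-true; dec-false; _×-dec_)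
open import Relation.Binary.PropositionalEquality
  using (_≡_; _≢_; refl; sym; trans; cong; cong₂; subst; _≗_; module ≡-Reasoning)
open import Data.Nat.Tactic.RingSolver as ℕ-Solver using ()
open import Data.Integer.Tactic.RingSolver as ℤ-Solver using ()

private
  variable
    A B : Set

∧≡true⁻ : ∀ {a b} → a ∧ b ≡ true → a ≡ true × b ≡ true
∧≡true⁻ {true} b≡true = refl , b≡true

∧≡true⁺ : ∀ {a b} → a ≡ true → b ≡ true → a ∧ b ≡ true
∧≡true⁺ refl refl = refl

does-sound : ∀ (a? : Dec A) → T (does a?) → A
does-sound (yes a) _ = a

does-complete : ∀ (a? : Dec A) → A → T (does a?)
does-complete a? a = Equivalence.from T-≡ (dec-true a? a)

count : (A → Bool) → List A → ℕ
count f []       = 0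
count f (x ∷ xs) = indicator (f x) ℕ.+ count f xs

filterᵇ : (A → Bool) → List A → List A
filterᵇ f = filter (λ x → f x ≟ᵇ true)

length-filterᵇ : ∀ (f : A → Bool) xs → length (filterᵇ f xs) ≡ count f xs
length-filterᵇ f []       = refl
length-filterᵇ f (x ∷ xs) with f x
... | true  = cong suc (length-filterᵇ f xs)
... | false = length-filterᵇ f xs

count-cong : ∀ {f g : A → Bool} → f ≗ g → ∀ xs → count f xs ≡ count g xs
count-cong f≗g []       = refl
count-cong f≗g (x ∷ xs) = cong₂ ℕ._+_ (cong indicator (f≗g x)) (count-cong f≗g xs)

count-map : ∀ (f : A → Bool) (g : B → A) xs → count (f ∘ g) xs ≡ count f (map g xs)
count-map f g []       = refl
count-map f g (x ∷ xs) = cong (indicator (f (g x)) ℕ.+_) (count-map f g xs)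

count-++ : ∀ (f : A → Bool) xs ys → count f (xs ++ ys) ≡ count f xs ℕ.+ count f ys
count-++ f []       ys = refl
count-++ f (x ∷ xs) ys = trans (cong (indicator (f x) ℕ.+_) (count-++ f xs ys)) (sym (ℕ.+-assoc (indicator (f x)) _ _))

count-concatMap : ∀ (g : A → Bool) (f : B → List A) xs → count g (concatMap f xs) ≡ sum (map (count g ∘ f) xs)
count-concatMap g f []       = refl
count-concatMap g f (x ∷ xs) = trans (count-++ g (f x) (concatMap f xs)) (cong (count g (f x) ℕ.+_) (count-concatMap g f xs))

count-filterᵇ : ∀ (f g : A → Bool) xs → count g (filterᵇ f xs) ≡ count (λ x → f x ∧ g x) xs
count-filterᵇ f g []       = refl
count-filterᵇ f g (x ∷ xs) with f x
... | true  = cong (indicator (g x) ℕ.+_) (count-filterᵇ f g xs)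
... | false = count-filterᵇ f g xs

count-none : ∀ {f : A → Bool} xs → (∀ x → f x ≡ false) → count f xs ≡ 0
count-none []       _    = refl
count-none (x ∷ xs) none rewrite none x = count-none xs none

count-id+count-not : ∀ ds → count id ds ℕ.+ count not ds ≡ length ds
count-id+count-not []           = refl
count-id+count-not (true ∷ ds)  = cong suc (count-id+count-not ds)
count-id+count-not (false ∷ ds) = trans (ℕ.+-suc (count id ds) (count not ds)) (cong suc (count-id+count-not ds))

0≡a*0+b*0 : ∀ a b → 0ℤ ≡ a * 0ℤ + b * 0ℤ
0≡a*0+b*0 = ℤ-Solver.solve-∀

sum-indicators : ∀ (c : A → ℕ) (g h : A → Bool) (a b : ℤ) xs →
  (∀ {x} → x ∈ xs → + c x ≡ a * + indicator (g x) + b * + indicator (h x)) →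
  + sum (map c xs) ≡ a * + count g xs + b * + count h xs
sum-indicators c g h a b []       _     = 0≡a*0+b*0 a b
sum-indicators c g h a b (x ∷ xs) c-x≡ = begin
  + (c x ℕ.+ sum (map c xs))
    ≡⟨ ℤ.pos-+ (c x) (sum (map c xs)) ⟩
  + c x + + sum (map c xs)
    ≡⟨ cong₂ _+_ (c-x≡ (here refl)) (sum-indicators c g h a b xs (c-x≡ ∘ there)) ⟩
  (a * + indicator (g x) + b * + indicator (h x)) + (a * + count g xs + b * + count h xs)
    ≡⟨ regroup a b (+ indicator (g x)) (+ indicator (h x)) (+ count g xs) (+ count h xs) ⟩
  a * (+ indicator (g x) + + count g xs) + b * (+ indicator (h x) + + count h xs)
    ≡⟨ cong₂ (λ u v → a * u + b * v) (ℤ.pos-+ (indicator (g x)) (count g xs)) (ℤ.pos-+ (indicator (h x)) (count h xs)) ⟨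
  a * + count g (x ∷ xs) + b * + count h (x ∷ xs) ∎
  where
  open ≡-Reasoning
  regroup : ∀ a b i j s t → (a * i + b * j) + (a * s + b * t) ≡ a * (i + s) + b * (j + t)
  regroup = ℤ-Solver.solve-∀

removeMember : ∀ {x : A} xs → x ∈ xs → List A
removeMember (_ ∷ xs) (here _)  = xs
removeMember (y ∷ xs) (there p) = y ∷ removeMember xs p

length-removeMember : ∀ {x : A} xs (p : x ∈ xs) → length xs ≡ suc (length (removeMember xs p))
length-removeMember (_ ∷ xs) (here _)  = refl
length-removeMember (_ ∷ xs) (there p) = cong suc (length-removeMember xs p)

∈-removeMember : ∀ {x z : A} xs (p : x ∈ xs) → z ∈ xs → z ≢ x → z ∈ removeMember xs p
∈-removeMember (_ ∷ _)  (here refl) (here refl) z≢x = ⊥-elim (z≢x refl)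
∈-removeMember (_ ∷ _)  (here refl) (there q)   _   = q
∈-removeMember (_ ∷ _)  (there p)   (here refl) _   = here refl
∈-removeMember (_ ∷ xs) (there p)   (there q)   z≢x = there (∈-removeMember xs p q z≢x)

Unique-⊆⇒length≤ : ∀ (xs : List A) {ys} → Unique xs → xs ⊆ ys → length xs ≤ length ys
Unique-⊆⇒length≤ []       _            _  = z≤n
Unique-⊆⇒length≤ (x ∷ xs) {ys} (x∉ ∷ u) xs⊆ys =
  subst (suc (length xs) ≤_) (sym (length-removeMember ys x∈ys))
    (s≤s (Unique-⊆⇒length≤ xs u λ z∈xs →
      ∈-removeMember ys x∈ys (xs⊆ys (there z∈xs)) (λ { refl → All¬⇒¬Any x∉ z∈xs })))
  where x∈ys = xs⊆ys (here refl)

Unique-⊆-antisym⇒length≡ : ∀ {xs ys : List A} → Unique xs → Unique ys → xs ⊆ ys → ys ⊆ xs → length xs ≡ length ys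
Unique-⊆-antisym⇒length≡ {xs = xs} {ys} ux uy xs⊆ys ys⊆xs =
  ℕ.≤-antisym (Unique-⊆⇒length≤ xs ux xs⊆ys) (Unique-⊆⇒length≤ ys uy ys⊆xs)

∈⇒≢[] : ∀ {x : A} {l} → x ∈ l → l ≢ []
∈⇒≢[] () refl

Unique-++⁻ʳ : ∀ (xs : List A) {ys} → Unique (xs ++ ys) → Unique ys
Unique-++⁻ʳ []       u        = u
Unique-++⁻ʳ (_ ∷ xs) (_ ∷ u) = Unique-++⁻ʳ xs u

Unique-++⇒disjoint : ∀ (xs : List A) {ys z} → Unique (xs ++ ys) → z ∈ xs → z ∉ ys
Unique-++⇒disjoint (_ ∷ xs) (z∉ ∷ _) (here refl) z∈ys = All¬⇒¬Any z∉ (∈-++⁺ʳ xs z∈ys)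
Unique-++⇒disjoint (_ ∷ xs) (_ ∷ u)  (there z∈)  z∈ys = Unique-++⇒disjoint xs u z∈ z∈ys

Unique-concatMap⁺ : ∀ (f : A → List B) {xs} → Unique xs → (∀ {x} → x ∈ xs → Unique (f x)) →
  (∀ {x y} → x ∈ xs → y ∈ xs → x ≢ y → Disjoint (f x) (f y)) → Unique (concatMap f xs)
Unique-concatMap⁺ f {[]}     _          _        _        = []
Unique-concatMap⁺ f {x ∷ xs} (x∉ ∷ u) unique-f disjoint-f =
  Unique.++⁺ (unique-f (here refl)) (Unique-concatMap⁺ f u (unique-f ∘ there) λ x∈ y∈ → disjoint-f (there x∈) (there y∈))
    λ (z∈fx , z∈rest) → let y , y∈xs , z∈fy = find (∈-concatMap⁻ f z∈rest) in
      disjoint-f (here refl) (there y∈xs) (All.lookup x∉ y∈xs) (z∈fx , z∈fy)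

count-==-∉ : ∀ {x} l → x ∉ l → count (_== x) l ≡ 0
count-==-∉     []      _  = refl
count-==-∉ {x} (y ∷ l) x∉ rewrite dec-false (y ℤ.≟ x) (x∉ ∘ here ∘ sym) = count-==-∉ l (x∉ ∘ there)

count-==-∈ : ∀ {x} l → Unique l → x ∈ l → count (_== x) l ≡ 1
count-==-∈     (y ∷ l) (y∉ ∷ _) (here refl) rewrite dec-true (y ℤ.≟ y) refl = cong suc (count-==-∉ l (All¬⇒¬Any y∉))
count-==-∈ {x} (y ∷ l) (y∉ ∷ u) (there x∈)  rewrite dec-false (y ℤ.≟ x) (λ { refl → All¬⇒¬Any y∉ x∈ }) = count-==-∈ l u x∈

data Insertion {A : Set} (v : A) : List A → List A → Set where
  here  : ∀ {l} → Insertion v l (v ∷ l)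
  there : ∀ {x l′ l} → Insertion v l′ l → Insertion v (x ∷ l′) (x ∷ l)

module _ {A : Set} {v : A} where

  ∈-insertion⁻ : ∀ {l′ l z} → Insertion v l′ l → z ∈ l → z ≡ v ⊎ z ∈ l′
  ∈-insertion⁻ here      (here z≡v) = inj₁ z≡v
  ∈-insertion⁻ here      (there z∈) = inj₂ z∈
  ∈-insertion⁻ (there _) (here z≡x) = inj₂ (here z≡x)
  ∈-insertion⁻ (there i) (there z∈) with ∈-insertion⁻ i z∈
  ... | inj₁ z≡v  = inj₁ z≡v
  ... | inj₂ z∈l′ = inj₂ (there z∈l′)

  ∈-insertion⁺ : ∀ {l′ l z} → Insertion v l′ l → z ∈ l′ → z ∈ l
  ∈-insertion⁺ here      z∈         = there z∈
  ∈-insertion⁺ (there _) (here z≡x) = here z≡x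
  ∈-insertion⁺ (there i) (there z∈) = there (∈-insertion⁺ i z∈)

  inserted∈ : ∀ {l′ l} → Insertion v l′ l → v ∈ l
  inserted∈ here      = here refl
  inserted∈ (there i) = there (inserted∈ i)

  length-insertion : ∀ {l′ l} → Insertion v l′ l → length l ≡ suc (length l′)
  length-insertion here      = refl
  length-insertion (there i) = cong suc (length-insertion i)

  ∈⇒insertion : ∀ {l} → v ∈ l → ∃ λ l′ → Insertion v l′ l
  ∈⇒insertion (here refl) = _ , here
  ∈⇒insertion (there v∈)  = let l′ , i = ∈⇒insertion v∈ in _ , there i

  unique-insertion⁻ : ∀ {l′ l} → Insertion v l′ l → Unique l → Unique l′ × v ∉ l′
  unique-insertion⁻ here      (v∉ ∷ u) = u , All¬⇒¬Any v∉
  unique-insertion⁻ (there i) (x∉ ∷ u) with unique-insertion⁻ i u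
  ... | u′ , v∉l′ = ¬Any⇒All¬ _ (All¬⇒¬Any x∉ ∘ ∈-insertion⁺ i) ∷ u′ ,
    λ { (here refl) → All¬⇒¬Any x∉ (inserted∈ i) ; (there v∈) → v∉l′ v∈ }

  unique-insertion⁺ : ∀ {l′ l} → Insertion v l′ l → Unique l′ → v ∉ l′ → Unique l
  unique-insertion⁺ here      u        v∉ = ¬Any⇒All¬ _ v∉ ∷ u
  unique-insertion⁺ (there i) (x∉ ∷ u) v∉ = ¬Any⇒All¬ _ x∉l ∷ unique-insertion⁺ i u (v∉ ∘ there)
    where
    x∉l : _ ∉ _
    x∉l x∈ with ∈-insertion⁻ i x∈
    ... | inj₁ refl = v∉ (here refl)
    ... | inj₂ x∈′  = All¬⇒¬Any x∉ x∈′

  insertion-injective : ∀ {w l₁ l₂ l} → Insertion v l₁ l → Insertion w l₂ l → v ∉ l₂ → w ∉ l₁ → l₁ ≡ l₂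
  insertion-injective here      here      _   _   = refl
  insertion-injective here      (there _) v∉  _   = ⊥-elim (v∉ (here refl))
  insertion-injective (there _) here      _   w∉  = ⊥-elim (w∉ (here refl))
  insertion-injective (there i) (there j) v∉  w∉  = cong (_ ∷_) (insertion-injective i j (v∉ ∘ there) (w∉ ∘ there))

-- The signed range [[n]]

data InRange (n : ℕ) : ℤ → Set where
  pos : ∀ {i} → i ℕ.< n → InRange n (+ suc i)
  neg : ∀ {i} → i ℕ.< n → InRange n -[1+ i ]

-- [[n]] ∪ {0}, the values allowed in a window padded by zeros
data InRange₀ (n : ℕ) : ℤ → Set where
  origin : InRange₀ n 0ℤ
  signed : ∀ {x} → InRange n x → InRange₀ n x

∈-signedRange⁻ : ∀ n {x} → x ∈ signedRange n → InRange n x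
∈-signedRange⁻ n x∈ with ∈-++⁻ (map -_ (positives n)) x∈
... | inj₁ x∈neg with ∈-map⁻ -_ x∈neg
...   | _ , y∈pos , refl with ∈-map⁻ (λ i → + suc i) y∈pos
...     | _ , i∈ , refl = neg (∈-upTo⁻ i∈)
∈-signedRange⁻ n x∈ | inj₂ x∈pos with ∈-map⁻ (λ i → + suc i) x∈pos
... | _ , i∈ , refl = pos (∈-upTo⁻ i∈)

∈-signedRange⁺ : ∀ n {x} → InRange n x → x ∈ signedRange n
∈-signedRange⁺ n (pos i<n) = ∈-++⁺ʳ (map -_ (positives n)) (∈-map⁺ (λ i → + suc i) (∈-upTo⁺ i<n))
∈-signedRange⁺ n (neg i<n) = ∈-++⁺ˡ (∈-map⁺ -_ (∈-map⁺ (λ i → + suc i) (∈-upTo⁺ i<n)))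

signedRange-unique : ∀ n → Unique (signedRange n)
signedRange-unique n =
  Unique.++⁺ (Unique.map⁺ ℤ.neg-injective positives-unique) positives-unique
    λ (x∈neg , x∈pos) → disjoint (∈-signedRange⁻ n (∈-++⁺ˡ x∈neg)) x∈neg x∈pos
  where
  positives-unique : Unique (positives n)
  positives-unique = Unique.map⁺ (λ { refl → refl }) (Unique.upTo⁺ n)
  disjoint : ∀ {x} → InRange n x → x ∈ map -_ (positives n) → x ∉ positives n
  disjoint (pos _) x∈neg _ with ∈-map⁻ -_ x∈neg
  ... | _ , y∈pos , eq with ∈-map⁻ (λ i → + suc i) y∈pos
  disjoint (pos _) _ _ | _ , _ , () | _ , _ , refl
  disjoint (neg _) _ x∈pos with ∈-map⁻ (λ i → + suc i) x∈pos
  ... | _ , _ , ()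

length-signedRange : ∀ n → length (signedRange n) ≡ n ℕ.+ n
length-signedRange n = begin
  length (map -_ (positives n) ++ positives n)            ≡⟨ List.length-++ (map -_ (positives n)) ⟩
  length (map -_ (positives n)) ℕ.+ length (positives n) ≡⟨ cong (ℕ._+ length (positives n)) (List.length-map -_ (positives n)) ⟩
  length (positives n) ℕ.+ length (positives n)          ≡⟨ cong₂ ℕ._+_ length-positives length-positives ⟩
  n ℕ.+ n                                                 ∎
  where
  open ≡-Reasoning
  length-positives : length (positives n) ≡ n
  length-positives = trans (List.length-map _ (upTo n)) (List.length-upTo n)

InRange-neg : ∀ {n x} → InRange n x → InRange n (- x)
InRange-neg (pos i<n) = neg i<n
InRange-neg (neg i<n) = pos i<n

InRange-suc : ∀ {n x} → InRange n x → InRange (suc n) x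
InRange-suc (pos i<n) = pos (ℕ.m<n⇒m<1+n i<n)
InRange-suc (neg i<n) = neg (ℕ.m<n⇒m<1+n i<n)

InRange-pred : ∀ {n x} → InRange (suc n) x → x ≢ + suc n → x ≢ -[1+ n ] → InRange n x
InRange-pred (pos i≤n) x≢n _  = pos (ℕ.≤∧≢⇒< (ℕ.≤-pred i≤n) (x≢n ∘ cong (+_ ∘ suc)))
InRange-pred (neg i≤n) _ x≢n̄ = neg (ℕ.≤∧≢⇒< (ℕ.≤-pred i≤n) (x≢n̄ ∘ cong -[1+_]))

InRange⇒≤ : ∀ {n x} → InRange n x → x ℤ.≤ + n
InRange⇒≤ (pos i<n) = ℤ.+≤+ i<n
InRange⇒≤ (neg _)   = ℤ.-≤+

InRange⇒≥ : ∀ {n x} → InRange (suc n) x → -[1+ n ] ℤ.≤ x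
InRange⇒≥ (pos _)         = ℤ.-≤+
InRange⇒≥ (neg (s≤s i≤n)) = ℤ.-≤- i≤n

InRange₀⇒≤ : ∀ {n x} → InRange₀ n x → x ℤ.≤ + n
InRange₀⇒≤ origin     = ℤ.+≤+ z≤n
InRange₀⇒≤ (signed r) = InRange⇒≤ r

InRange₀⇒≥ : ∀ {n x} → InRange₀ (suc n) x → -[1+ n ] ℤ.≤ x
InRange₀⇒≥ origin     = ℤ.-≤+
InRange₀⇒≥ (signed r) = InRange⇒≥ r

-- Big gaps a ≪ b

≪-intro : ∀ {a n b} c → InRange n c → a ℤ.< c → c ℤ.< b → (a ≪[ n ] b) ≡ true
≪-intro {a} {n} {b} c c∈ a<c c<b = Equivalence.to T-≡ (any⁺ _ (lose (∈-signedRange⁺ n c∈)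
  (Equivalence.from T-≡ (dec-true (a ℤ.<? c ×-dec c ℤ.<? b) (a<c , c<b)))))

≪-elim : ∀ {a n b} → (a ≪[ n ] b) ≡ true → ∃ λ c → InRange n c × a ℤ.< c × c ℤ.< b
≪-elim {a} {n} {b} a≪b with find (any⁻ _ (signedRange n) (Equivalence.from T-≡ a≪b))
... | c , c∈ , a<c<b = c , ∈-signedRange⁻ n c∈ , does-sound (a ℤ.<? c ×-dec c ℤ.<? b) a<c<b

≪-false : ∀ {a n b} → (∀ {c} → InRange n c → a ℤ.< c → c ℤ.< b → ⊥) → (a ≪[ n ] b) ≡ false
≪-false {a} {n} {b} no-gap = ¬-not λ a≪b → let c , c∈ , a<c , c<b = ≪-elim {a} {n} {b} a≪b in no-gap c∈ a<c c<b

≪-suc : ∀ {m a b} → InRange₀ m a → InRange₀ m b → (a ≪[ m ] b) ≡ (a ≪[ suc m ] b)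
≪-suc {m} {a} {b} a∈ b∈ with (a ≪[ m ] b) in small | (a ≪[ suc m ] b) in large
... | true  | true  = refl
... | false | false = refl
... | true  | false = let c , c∈ , a<c , c<b = ≪-elim {a} {m} {b} small in
  sym (trans (sym large) (≪-intro {a} {suc m} {b} c (InRange-suc c∈) a<c c<b))
... | false | true  = let c , c∈ , a<c , c<b = ≪-elim {a} {suc m} {b} large in
  trans (sym small) (≪-intro {a} {m} {b} c (shrink c∈ a<c c<b) a<c c<b)
  where
  shrink : ∀ {c} → InRange (suc m) c → a ℤ.< c → c ℤ.< b → InRange m c
  shrink (pos _) _ c<b = pos (ℕ.<⇒≤ (ℤ.drop‿+<+ (ℤ.<-≤-trans c<b (InRange₀⇒≤ b∈))))
  shrink (neg _) a<c _ = neg (below a∈ a<c)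
    where
    below : ∀ {i a} → InRange₀ m a → a ℤ.< -[1+ i ] → i ℕ.< m
    below (signed (neg j<m)) (ℤ.-<- i<j) = ℕ.<-trans i<j j<m

no-gap-between-succ : ∀ {j c} → + j ℤ.< c → c ℤ.< + suc j → ⊥
no-gap-between-succ {c = + _} (ℤ.+<+ j<i) (ℤ.+<+ i<1+j) = ℕ.<-irrefl refl (ℕ.<-≤-trans j<i (ℕ.≤-pred i<1+j))

no-gap-between-succ⁻ : ∀ {j c} → -[1+ suc j ] ℤ.< c → c ℤ.< -[1+ j ] → ⊥
no-gap-between-succ⁻ {c = -[1+ _ ]} (ℤ.-<- i<1+j) (ℤ.-<- j<i) = ℕ.<-irrefl refl (ℕ.<-≤-trans j<i (ℕ.≤-pred i<1+j))

≤ᵇ⇔0≪ : ∀ {m x} → InRange (suc m) x → (+ 2 ≤ᵇ x) ≡ (0ℤ ≪[ suc m ] x)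
≤ᵇ⇔0≪ {m} (pos {suc i} _) = trans (dec-true (+ 2 ℤ.≤? + suc (suc i)) (ℤ.+≤+ (s≤s (s≤s z≤n))))
  (sym (≪-intro {0ℤ} {suc m} {+ suc (suc i)} 1ℤ (pos (s≤s z≤n)) (ℤ.+<+ (s≤s z≤n)) (ℤ.+<+ (s≤s (s≤s z≤n)))))
≤ᵇ⇔0≪ {m} (pos {zero} _) = trans (dec-false (+ 2 ℤ.≤? 1ℤ) λ { (ℤ.+≤+ (s≤s ())) })
  (sym (≪-false {0ℤ} {suc m} λ _ → no-gap-between-succ))
≤ᵇ⇔0≪ {m} (neg {i} _) = trans (dec-false (+ 2 ℤ.≤? -[1+ i ]) λ ())
  (sym (≪-false {0ℤ} {suc m} λ { _ (ℤ.+<+ _) () }))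

≤ᵇ⇔≪0 : ∀ {m x} → InRange (suc m) x → (x ≤ᵇ -[1+ 1 ]) ≡ (x ≪[ suc m ] 0ℤ)
≤ᵇ⇔≪0 {m} (neg {suc i} _) = trans (dec-true (-[1+ suc i ] ℤ.≤? -[1+ 1 ]) (ℤ.-≤- (s≤s z≤n)))
  (sym (≪-intro { -[1+ suc i ]} {suc m} {0ℤ} -[1+ 0 ] (neg (s≤s z≤n)) (ℤ.-<- (s≤s z≤n)) ℤ.-<+))
≤ᵇ⇔≪0 {m} (neg {zero} _) = trans (dec-false (-[1+ 0 ] ℤ.≤? -[1+ 1 ]) λ { (ℤ.-≤- ()) })
  (sym (≪-false { -[1+ 0 ]} {suc m} λ { _ (ℤ.-<- ()) ℤ.-<+ ; _ ℤ.-<+ (ℤ.+<+ ()) }))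
≤ᵇ⇔≪0 {m} (pos {i} _) = trans (dec-false (+ suc i ℤ.≤? -[1+ 1 ]) λ ())
  (sym (≪-false {+ suc i} {suc m} λ { _ (ℤ.+<+ _) (ℤ.+<+ ()) }))

bascList : ℕ → List ℤ → ℕ
bascList n l = ascFirst l ℕ.+ ascMiddle n l ℕ.+ ascLast l

pad : List ℤ → List ℤ
pad l = 0ℤ ∷ l ++ [ 0ℤ ]

ascMiddle-++0 : ∀ {m} x r → All (InRange (suc m)) (x ∷ r) →
  ascMiddle (suc m) (x ∷ r ++ [ 0ℤ ]) ≡ ascMiddle (suc m) (x ∷ r) ℕ.+ ascLast (x ∷ r)
ascMiddle-++0 x []      (x∈ ∷ _)  = trans (ℕ.+-identityʳ _) (cong indicator (sym (≤ᵇ⇔≪0 x∈)))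
ascMiddle-++0 {m} x (y ∷ r) (_ ∷ yr∈) = trans (cong (indicator (x ≪[ suc m ] y) ℕ.+_) (ascMiddle-++0 y r yr∈))
  (sym (ℕ.+-assoc (indicator (x ≪[ suc m ] y)) _ _))

bascList≡ascMiddle-pad : ∀ {m} l → All (InRange (suc m)) l → l ≢ [] → bascList (suc m) l ≡ ascMiddle (suc m) (pad l)
bascList≡ascMiddle-pad []      _              l≢[] = ⊥-elim (l≢[] refl)
bascList≡ascMiddle-pad (x ∷ r) xr∈@(x∈ ∷ _) _    =
  trans (ℕ.+-assoc (ascFirst (x ∷ r)) _ _)
    (cong₂ ℕ._+_ (cong indicator (≤ᵇ⇔0≪ x∈)) (sym (ascMiddle-++0 x r xr∈)))

ascMiddle-suc : ∀ m u → All (InRange₀ m) u → ascMiddle m u ≡ ascMiddle (suc m) u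
ascMiddle-suc m []          _                  = refl
ascMiddle-suc m (x ∷ [])    _                  = refl
ascMiddle-suc m (x ∷ y ∷ u) (x∈ ∷ yu∈@(y∈ ∷ _)) =
  cong₂ ℕ._+_ (cong indicator (≪-suc x∈ y∈)) (ascMiddle-suc m (y ∷ u) yu∈)

inXList : ℕ → List ℤ → Bool
inXList n l = (all (λ y → member y (signedRange n)) (map -_ l ++ l) ∧ noDup (map -_ l ++ l)) ∧ any (_== 1ℤ) l

applyUpTo-nth : ∀ (f : ℤ → B) l → applyUpTo (f ∘ nth l) (length l) ≡ map f l
applyUpTo-nth f []      = refl
applyUpTo-nth f (x ∷ l) = cong (f x ∷_) (applyUpTo-nth f l)

length-toList : ∀ {n} (w : Vec A n) → length (toList w) ≡ n
length-toList []ᵥ       = refl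
length-toList (_ ∷ᵥ w) = cong suc (length-toList w)

map-window : ∀ {n} (f : ℤ → B) (w : Vec ℤ n) → map (f ∘ nth (toList w)) (upTo n) ≡ map f (toList w)
map-window f w = subst (λ n → map (f ∘ nth (toList w)) (upTo n) ≡ map f (toList w)) (length-toList w)
  (trans (List.map-upTo (f ∘ nth (toList w)) _) (applyUpTo-nth f (toList w)))

map-ext-signedRange : ∀ {n} (w : Vec ℤ n) → map (ext w) (signedRange n) ≡ map -_ (toList w) ++ toList w
map-ext-signedRange {n} w = begin
  map (ext w) (map -_ (positives n) ++ positives n)
    ≡⟨ List.map-++ (ext w) (map -_ (positives n)) (positives n) ⟩
  map (ext w) (map -_ (positives n)) ++ map (ext w) (positives n)
    ≡⟨ cong₂ _++_ (trans (sym (List.map-∘ (positives n))) (sym (List.map-∘ (upTo n))))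
                  (sym (List.map-∘ (upTo n))) ⟩
  map (-_ ∘ nth (toList w)) (upTo n) ++ map (id ∘ nth (toList w)) (upTo n)
    ≡⟨ cong₂ _++_ (map-window -_ w) (trans (map-window id w) (List.map-id (toList w))) ⟩
  map -_ (toList w) ++ toList w ∎
  where open ≡-Reasoning

inX≡inXList : ∀ n (w : Vec ℤ n) → inX n w ≡ inXList n (toList w)
inX≡inXList n w = cong₂ _∧_
  (cong (λ images → all (λ y → member y (signedRange n)) images ∧ noDup images) (map-ext-signedRange w))
  (cong or (trans (sym (List.map-∘ (upTo n))) (map-window (_== 1ℤ) w)))

allLists : List ℤ → ℕ → List (List ℤ)
allLists A n = map toList (allVecs A n)

allLists-suc : ∀ A n → allLists A (suc n) ≡ concatMap (λ x → map (x ∷_) (allLists A n)) A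
allLists-suc A n = trans (List.map-concatMap toList (λ x → map (x ∷ᵥ_) (allVecs A n)) A)
  (List.concatMap-cong (λ x → trans (sym (List.map-∘ (allVecs A n))) (List.map-∘ (allVecs A n))) A)

∈-allLists⁻ : ∀ A n {l} → l ∈ allLists A n → length l ≡ n × l ⊆ A
∈-allLists⁻ A zero    (here refl) = refl , λ ()
∈-allLists⁻ A (suc n) {l} l∈ with find (∈-concatMap⁻ _ {xs = A} (subst (l ∈_) (allLists-suc A n) l∈))
... | x , x∈A , l∈x∷ with ∈-map⁻ (x ∷_) l∈x∷
...   | l′ , l′∈ , refl with ∈-allLists⁻ A n l′∈
...     | length≡ , l′⊆A = cong suc length≡ , λ { (here refl) → x∈A ; (there y∈) → l′⊆A y∈ }

∈-allLists⁺ : ∀ A n {l} → length l ≡ n → l ⊆ A → l ∈ allLists A n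
∈-allLists⁺ A zero    {[]}    _       _   = here refl
∈-allLists⁺ A (suc n) {x ∷ l} length≡ l⊆A = subst (_ ∈_) (sym (allLists-suc A n))
  (∈-concatMap⁺ _ (lose (l⊆A (here refl))
    (∈-map⁺ (x ∷_) (∈-allLists⁺ A n (ℕ.suc-injective length≡) (l⊆A ∘ there)))))

allLists-unique : ∀ A n → Unique A → Unique (allLists A n)
allLists-unique A zero    _   = [] ∷ []
allLists-unique A (suc n) u-A = subst Unique (sym (allLists-suc A n)) (Unique.concat⁺ all-unique pairwise-disjoint)
  where
  rows : List (List (List ℤ))
  rows = map (λ x → map (x ∷_) (allLists A n)) A
  all-unique : All Unique rows
  all-unique = All.tabulate λ row∈ → row-unique (∈-map⁻ _ row∈)
    where
    row-unique : ∀ {row} → ∃ (λ x → x ∈ A × row ≡ map (x ∷_) (allLists A n)) → Unique row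
    row-unique (_ , _ , refl) = Unique.map⁺ (λ { refl → refl }) (allLists-unique A n u-A)
  heads-differ : ∀ {x y} → x ≢ y → ∀ {l} → l ∈ map (x ∷_) (allLists A n) → l ∉ map (y ∷_) (allLists A n)
  heads-differ x≢y l∈ l∈′ with ∈-map⁻ _ l∈ | ∈-map⁻ _ l∈′
  ... | _ , _ , refl | _ , _ , refl = x≢y refl
  pairwise-disjoint : AllPairs Disjoint rows
  pairwise-disjoint = AllPairs.map⁺ (AllPairs.map (λ x≢y {l} (l∈ , l∈′) → heads-differ x≢y l∈ l∈′) u-A)

ψ≡count : ∀ n k → ψ n k ≡ count (λ l → inXList n l ∧ (+ bascList n l == k)) (allLists (signedRange n) n)
ψ≡count n k = begin
  length (filterᵇ (λ w → inX n w ∧ (+ basc n w == k)) vecs)     ≡⟨ length-filterᵇ _ vecs ⟩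
  count (λ w → inX n w ∧ (+ basc n w == k)) vecs                ≡⟨ count-cong (λ w → cong (_∧ (+ basc n w == k)) (inX≡inXList n w)) vecs ⟩
  count ((λ l → inXList n l ∧ (+ bascList n l == k)) ∘ toList) vecs ≡⟨ count-map _ toList vecs ⟩
  count (λ l → inXList n l ∧ (+ bascList n l == k)) (map toList vecs) ∎
  where
  open ≡-Reasoning
  vecs = allVecs (signedRange n) n

member-sound : ∀ {x} ys → T (member x ys) → x ∈ ys
member-sound {x} ys x∈ = Any.map (does-sound (x ℤ.≟ _)) (any⁻ _ ys x∈)

member-complete : ∀ {x ys} → x ∈ ys → T (member x ys)
member-complete {x} x∈ = any⁺ _ (Any.map (does-complete (x ℤ.≟ _)) x∈)

noDup⇒Unique : ∀ xs → T (noDup xs) → Unique xs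
noDup⇒Unique []       _ = []
noDup⇒Unique (x ∷ xs) h with member x xs in fresh
... | false = ¬Any⇒All¬ xs (λ x∈xs → subst T fresh (member-complete x∈xs)) ∷ noDup⇒Unique xs h

Unique⇒noDup : ∀ {xs} → Unique xs → T (noDup xs)
Unique⇒noDup []                      = _
Unique⇒noDup {x ∷ xs} (x∉xs ∷ u) with member x xs in stale
... | false = Unique⇒noDup u
... | true  = All¬⇒¬Any x∉xs (member-sound xs (subst T (sym stale) _))

-- A window is signed-unique when w is injective on [[n]]: no value occurs twice up to sign.
SignedUnique : List ℤ → Set
SignedUnique l = Unique l × (∀ {x} → x ∈ l → - x ∉ l)

∈-signedImages⁻ : ∀ {x} l → x ∈ map -_ l ++ l → x ∈ l ⊎ - x ∈ l
∈-signedImages⁻ l x∈ with ∈-++⁻ (map -_ l) x∈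
... | inj₂ x∈l = inj₁ x∈l
... | inj₁ x∈-l with ∈-map⁻ -_ x∈-l
...   | y , y∈l , refl = inj₂ (subst (_∈ l) (sym (ℤ.neg-involutive y)) y∈l)

signedImages-unique⁻ : ∀ l → Unique (map -_ l ++ l) → SignedUnique l
signedImages-unique⁻ l u = Unique-++⁻ʳ (map -_ l) u , λ x∈ -x∈ → Unique-++⇒disjoint (map -_ l) u (∈-map⁺ -_ x∈) -x∈

signedImages-unique⁺ : ∀ l → SignedUnique l → Unique (map -_ l ++ l)
signedImages-unique⁺ l (u , ±-fresh) = Unique.++⁺ (Unique.map⁺ ℤ.neg-injective u) u disjoint
  where
  disjoint : ∀ {v} → v ∈ map -_ l × v ∈ l → ⊥
  disjoint (v∈-l , v∈l) with ∈-map⁻ -_ v∈-l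
  ... | _ , y∈l , refl = ±-fresh y∈l v∈l

record IsX (n : ℕ) (l : List ℤ) : Set where
  constructor isX
  field
    inRange      : ∀ {x} → x ∈ l → InRange n x
    signedUnique : SignedUnique l
    one∈         : 1ℤ ∈ l

inXList⇒IsX : ∀ n l → inXList n l ≡ true → IsX n l
inXList⇒IsX n l h with Equivalence.to (T-∧ {_} {any (_== 1ℤ) l}) (Equivalence.from T-≡ h)
... | isBn , has1 with Equivalence.to (T-∧ {all (λ y → member y (signedRange n)) (map -_ l ++ l)}) isBn
...   | images∈ , images-noDup = isX
  (λ x∈ → ∈-signedRange⁻ n (member-sound (signedRange n) (All.lookup (all⁺ _ _ images∈) (∈-++⁺ʳ (map -_ l) x∈))))
  (signedImages-unique⁻ l (noDup⇒Unique _ images-noDup))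
  (let x , x∈ , x≡1 = find (any⁻ _ l has1) in subst (_∈ l) (does-sound (x ℤ.≟ 1ℤ) x≡1) x∈)

IsX⇒inXList : ∀ n l → IsX n l → inXList n l ≡ true
IsX⇒inXList n l (isX inRange signedUnique one∈) = Equivalence.to T-≡
  (Equivalence.from T-∧ (Equivalence.from T-∧ (images∈ , Unique⇒noDup (signedImages-unique⁺ l signedUnique)) ,
                        any⁺ _ (lose one∈ (does-complete (1ℤ ℤ.≟ 1ℤ) refl))))
  where
  images∈ : T (all (λ y → member y (signedRange n)) (map -_ l ++ l))
  images∈ = all⁻ _ (All.tabulate λ {y} y∈ → member-complete (∈-signedRange⁺ n (in-range (∈-signedImages⁻ l y∈))))
    where
    in-range : ∀ {y} → y ∈ l ⊎ - y ∈ l → InRange n y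
    in-range (inj₁ y∈)  = inRange y∈
    in-range {y} (inj₂ -y∈) = subst (InRange n) (ℤ.neg-involutive y) (InRange-neg (inRange -y∈))

-- The 2n signed images of a window of X_n fill [[n]], so ±n must be among them.
±top∈window : ∀ m l → length l ≡ suc m → IsX (suc m) l → + suc m ∈ l ⊎ -[1+ m ] ∈ l
±top∈window m l length≡ (isX inRange signedUnique _) with + suc m ∈? l | -[1+ m ] ∈? l
... | yes top∈ | _       = inj₁ top∈
... | no  _    | yes -top∈ = inj₂ -top∈
... | no top∉  | no -top∉ = ⊥-elim (ℕ.<-irrefl refl (ℕ.<-≤-trans more fewer))
  where
  n = suc m
  images = map -_ l ++ l
  length-images : length images ≡ n ℕ.+ n
  length-images = trans (List.length-++ (map -_ l)) (cong₂ ℕ._+_ (trans (List.length-map -_ l) length≡) length≡)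
  top∉images : + n ∉ images
  top∉images top∈ with ∈-signedImages⁻ l top∈
  ... | inj₁ top∈l  = top∉ top∈l
  ... | inj₂ -top∈l = -top∉ -top∈l
  ⊆signedRange : (+ n ∷ images) ⊆ signedRange n
  ⊆signedRange (here refl) = ∈-signedRange⁺ n (pos (ℕ.n<1+n m))
  ⊆signedRange {y} (there y∈) with ∈-signedImages⁻ l y∈
  ... | inj₁ y∈l  = ∈-signedRange⁺ n (inRange y∈l)
  ... | inj₂ -y∈l = ∈-signedRange⁺ n (subst (InRange n) (ℤ.neg-involutive y) (InRange-neg (inRange -y∈l)))
  fewer : length (+ n ∷ images) ≤ n ℕ.+ n
  fewer = subst (length (+ n ∷ images) ≤_) (length-signedRange n)
    (Unique-⊆⇒length≤ (+ n ∷ images) (¬Any⇒All¬ images top∉images ∷ signedImages-unique⁺ l signedUnique) ⊆signedRange)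
  more : n ℕ.+ n ℕ.< length (+ n ∷ images)
  more = subst (ℕ._< suc (length images)) length-images (ℕ.n<1+n _)

signedUnique-insertion⁻ : ∀ {v l′ l} → Insertion v l′ l → SignedUnique l → SignedUnique l′ × v ∉ l′ × - v ∉ l′
signedUnique-insertion⁻ i (u , ±-fresh) with unique-insertion⁻ i u
... | u′ , v∉ = (u′ , λ x∈ -x∈ → ±-fresh (∈-insertion⁺ i x∈) (∈-insertion⁺ i -x∈)) , v∉ ,
                λ -v∈ → ±-fresh (inserted∈ i) (∈-insertion⁺ i -v∈)

signedUnique-insertion⁺ : ∀ {v l′ l} → Insertion v l′ l → SignedUnique l′ → v ∉ l′ → - v ∉ l′ → v ≢ - v → SignedUnique l
signedUnique-insertion⁺ {v} {l′} i (u , ±-fresh) v∉ -v∉ v≢-v =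
  unique-insertion⁺ i u v∉ , λ x∈ -x∈ → both (∈-insertion⁻ i x∈) (∈-insertion⁻ i -x∈)
  where
  both : ∀ {x} → x ≡ v ⊎ x ∈ l′ → - x ≡ v ⊎ - x ∈ l′ → ⊥
  both (inj₁ refl) (inj₁ -v≡v) = v≢-v (sym -v≡v)
  both (inj₁ refl) (inj₂ -v∈)  = -v∉ -v∈
  both {x} (inj₂ x∈) (inj₁ -x≡v) = -v∉ (subst (_∈ l′) (trans (sym (ℤ.neg-involutive x)) (cong -_ -x≡v)) x∈)
  both (inj₂ x∈) (inj₂ -x∈)  = ±-fresh x∈ -x∈

module _ (p : ℕ) where

  count-shift≡p : ∀ ds → count (λ d → + (indicator d ℕ.+ p) == + p) ds ≡ count not ds
  count-shift≡p = count-cong λ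
    { true  → dec-false (+ suc p ℤ.≟ + p) λ ()
    ; false → dec-true (+ p ℤ.≟ + p) refl }

  count-shift≡1+p : ∀ ds → count (λ d → + (indicator d ℕ.+ p) == + suc p) ds ≡ count id ds
  count-shift≡1+p = count-cong λ
    { true  → dec-true (+ suc p ℤ.≟ + suc p) refl
    ; false → dec-false (+ p ℤ.≟ + suc p) λ () }

  count-shift≡other : ∀ {K} ds → K ≢ + p → K ≢ + suc p → count (λ d → + (indicator d ℕ.+ p) == K) ds ≡ 0
  count-shift≡other {K} ds K≢p K≢1+p = count-none ds λ
    { true  → dec-false (+ suc p ℤ.≟ K) (K≢1+p ∘ sym)
    ; false → dec-false (+ p ℤ.≟ K) (K≢p ∘ sym) }

+p≢+p-1 : ∀ p → + p ≢ + p - 1ℤ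
+p≢+p-1 p p≡p-1 = ℤ.<-irrefl (sym p≡p-1) (ℤ.m⊖1+n<m p 1)

≢1+⇒≢-1 : ∀ p {K} → K ≢ + suc p → + p ≢ K - 1ℤ
≢1+⇒≢-1 p {K} K≢1+p p≡K-1 = K≢1+p (trans (K≡K-1+1 K) (cong (λ i → 1ℤ + i) (sym p≡K-1)))
  where
  K≡K-1+1 : ∀ K → K ≡ 1ℤ + (K - 1ℤ)
  K≡K-1+1 = ℤ-Solver.solve-∀

-- Where the coefficients of the recurrence come from: 2p + 1 of the values p + d (d ∈ ds) equal p.
count-shifted : ∀ p ds K → count not ds ≡ suc (p ℕ.+ p) →
  + count (λ d → + (indicator d ℕ.+ p) == K) ds
    ≡ (+ length ds - + 2 * K + 1ℤ) * + indicator (+ p == K - 1ℤ) + (+ 2 * K + 1ℤ) * + indicator (+ p == K)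
count-shifted p ds K #false≡ with K ℤ.≟ + p | K ℤ.≟ + suc p
... | yes refl | _
  rewrite dec-false (+ p ℤ.≟ + p - 1ℤ) (+p≢+p-1 p) | dec-true (+ p ℤ.≟ + p) refl | count-shift≡p p ds | #false≡
  = at-p (+ p) (+ length ds - + 2 * + p + 1ℤ)
  where
  at-p : ∀ p a → + 1 + (p + p) ≡ a * 0ℤ + (+ 2 * p + 1ℤ) * 1ℤ
  at-p = ℤ-Solver.solve-∀
... | no _ | yes refl
  rewrite dec-true (+ p ℤ.≟ + p) refl | dec-false (+ p ℤ.≟ + suc p) (λ ()) | count-shift≡1+p p ds
        | sym (count-id+count-not ds) | #false≡ | ℤ.pos-+ (count id ds) (suc (p ℕ.+ p))
  = at-1+p (+ count id ds) (+ p) (+ 2 * + suc p + 1ℤ)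
  where
  at-1+p : ∀ t p b → t ≡ (t + (+ 1 + (p + p)) - + 2 * (+ 1 + p) + 1ℤ) * 1ℤ + b * 0ℤ
  at-1+p = ℤ-Solver.solve-∀
... | no K≢p | no K≢1+p
  rewrite dec-false (+ p ℤ.≟ K - 1ℤ) (≢1+⇒≢-1 p K≢1+p)
        | dec-false (+ p ℤ.≟ K) (K≢p ∘ sym) | count-shift≡other p ds K≢p K≢1+p
  = 0≡a*0+b*0 (+ length ds - + 2 * K + 1ℤ) (+ 2 * K + 1ℤ)

-- From X_m to X_n, n = m + 1 ≥ 2, by inserting ±n into a window

module Extension (k : ℕ) where

  m n : ℕ
  m = suc k
  n = suc m

  N N̄ M M̄ : ℤ
  N = + n
  N̄ = -[1+ m ]
  M = + m
  M̄ = -[1+ k ]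

  N≪-false : ∀ {y} → InRange₀ m y → (N ≪[ n ] y) ≡ false
  N≪-false {y} y∈ = ≪-false {N} {n} {y} λ _ N<c c<y →
    ℤ.<-asym (ℤ.<-≤-trans (ℤ.<-trans N<c c<y) (InRange₀⇒≤ y∈)) (ℤ.+<+ (ℕ.n<1+n m))

  ≪N̄-false : ∀ {x} → (x ≪[ n ] N̄) ≡ false
  ≪N̄-false {x} = ≪-false {x} {n} {N̄} λ c∈ _ c<N̄ → ℤ.<-irrefl refl (ℤ.<-≤-trans c<N̄ (InRange⇒≥ c∈))

  ≪N-true : ∀ {x} → InRange₀ m x → x ≢ M → (x ≪[ n ] N) ≡ true
  ≪N-true {x} x∈ x≢M = ≪-intro {x} {n} {N} M (pos (ℕ.m<n⇒m<1+n (ℕ.n<1+n k)))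
    (ℤ.≤∧≢⇒< (InRange₀⇒≤ x∈) x≢M) (ℤ.+<+ (ℕ.n<1+n m))

  M≪N-false : (M ≪[ n ] N) ≡ false
  M≪N-false = ≪-false {M} {n} {N} λ _ → no-gap-between-succ

  N̄≪-true : ∀ {y} → InRange₀ m y → y ≢ M̄ → (N̄ ≪[ n ] y) ≡ true
  N̄≪-true {y} y∈ y≢M̄ = ≪-intro {N̄} {n} {y} M̄ (neg (ℕ.m<n⇒m<1+n (ℕ.n<1+n k)))
    (ℤ.-<- (ℕ.n<1+n k)) (ℤ.≤∧≢⇒< (InRange₀⇒≥ y∈) (y≢M̄ ∘ sym))

  N̄≪M̄-false : (N̄ ≪[ n ] M̄) ≡ false
  N̄≪M̄-false = ≪-false {N̄} {n} {M̄} λ _ → no-gap-between-succ⁻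

  M≪-false : ∀ {y n′} → InRange₀ m y → (M ≪[ n′ ] y) ≡ false
  M≪-false {y} {n′} y∈ = ≪-false {M} {n′} {y} λ _ M<c c<y → ℤ.<-asym M<c (ℤ.<-≤-trans c<y (InRange₀⇒≤ y∈))

  ≪M̄-false : ∀ {x n′} → InRange₀ m x → (x ≪[ n′ ] M̄) ≡ false
  ≪M̄-false {x} {n′} x∈ = ≪-false {x} {n′} {M̄} λ _ x<c c<M̄ → ℤ.<-asym c<M̄ (ℤ.≤-<-trans (InRange₀⇒≥ x∈) x<c)

  IsExtreme : ℤ → Set
  IsExtreme v = v ≡ N ⊎ v ≡ N̄

  extreme∉ : ∀ {v l} → IsExtreme v → (∀ {x} → x ∈ l → InRange m x) → v ∉ l
  extreme∉ (inj₁ refl) inRange N∈ with inRange N∈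
  ... | pos n<m = ℕ.<-irrefl refl n<m
  extreme∉ (inj₂ refl) inRange N̄∈ with inRange N̄∈
  ... | neg m<m = ℕ.<-irrefl refl m<m

  extensions : List ℤ → List (List ℤ)
  extensions []      = [ N ] ∷ [ N̄ ] ∷ []
  extensions (x ∷ r) = (N ∷ x ∷ r) ∷ (N̄ ∷ x ∷ r) ∷ map (x ∷_) (extensions r)

  ∈-extensions⁻ : ∀ l′ {l} → l ∈ extensions l′ → ∃ λ v → IsExtreme v × Insertion v l′ l
  ∈-extensions⁻ []      (here refl)         = N , inj₁ refl , here
  ∈-extensions⁻ []      (there (here refl)) = N̄ , inj₂ refl , here
  ∈-extensions⁻ (x ∷ r) (here refl)         = N , inj₁ refl , here
  ∈-extensions⁻ (x ∷ r) (there (here refl)) = N̄ , inj₂ refl , here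
  ∈-extensions⁻ (x ∷ r) (there (there l∈)) with ∈-map⁻ (x ∷_) l∈
  ... | _ , l∈r , refl = let v , extreme , i = ∈-extensions⁻ r l∈r in v , extreme , there i

  ∈-extensions⁺ : ∀ {v l′ l} → IsExtreme v → Insertion v l′ l → l ∈ extensions l′
  ∈-extensions⁺ {l′ = []}    (inj₁ refl) here      = here refl
  ∈-extensions⁺ {l′ = []}    (inj₂ refl) here      = there (here refl)
  ∈-extensions⁺ {l′ = _ ∷ _} (inj₁ refl) here      = here refl
  ∈-extensions⁺ {l′ = _ ∷ _} (inj₂ refl) here      = there (here refl)
  ∈-extensions⁺ {l′ = x ∷ _} extreme     (there i) = there (there (∈-map⁺ (x ∷_) (∈-extensions⁺ extreme i)))

  extensions-unique : ∀ l′ → N ∉ l′ → N̄ ∉ l′ → Unique (extensions l′)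
  extensions-unique []      _  _  = ((λ ()) ∷ []) ∷ [] ∷ []
  extensions-unique (x ∷ r) N∉ N̄∉ =
    ((λ ()) ∷ ¬Any⇒All¬ _ (N∉ ∘ head∈)) ∷ ¬Any⇒All¬ _ (N̄∉ ∘ head∈) ∷
      Unique.map⁺ (λ { refl → refl }) (extensions-unique r (N∉ ∘ there) (N̄∉ ∘ there))
    where
    head∈ : ∀ {v} → (v ∷ x ∷ r) ∈ map (x ∷_) (extensions r) → v ∈ x ∷ r
    head∈ l∈ with ∈-map⁻ (x ∷_) l∈
    ... | _ , _ , refl = here refl

  windowsXm : List (List ℤ)
  windowsXm = filterᵇ (inXList m) (allLists (signedRange m) m)

  windowsXn : List (List ℤ)
  windowsXn = allLists (signedRange n) n

  ∈-windowsXm⁻ : ∀ {l′} → l′ ∈ windowsXm → length l′ ≡ m × IsX m l′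
  ∈-windowsXm⁻ {l′} l′∈ with ∈-filter⁻ (λ l → inXList m l ≟ᵇ true) l′∈
  ... | l′∈all , inX = proj₁ (∈-allLists⁻ (signedRange m) m l′∈all) , inXList⇒IsX m l′ inX

  extended : List (List ℤ)
  extended = concatMap extensions windowsXm

  extended-unique : Unique extended
  extended-unique = Unique-concatMap⁺ extensions windowsXm-unique
    (λ l′∈ → extensions-unique _ (extreme∉ (inj₁ refl) (inRange l′∈)) (extreme∉ (inj₂ refl) (inRange l′∈)))
    λ l₁∈ l₂∈ l₁≢l₂ (l∈₁ , l∈₂) →
      let v , v-extreme , i = ∈-extensions⁻ _ l∈₁
          w , w-extreme , j = ∈-extensions⁻ _ l∈₂
      in l₁≢l₂ (insertion-injective i j (extreme∉ v-extreme (inRange l₂∈)) (extreme∉ w-extreme (inRange l₁∈)))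
    where
    windowsXm-unique : Unique windowsXm
    windowsXm-unique = Unique.filter⁺ _ (allLists-unique _ m (signedRange-unique m))
    inRange : ∀ {l′} → l′ ∈ windowsXm → ∀ {x} → x ∈ l′ → InRange m x
    inRange l′∈ = IsX.inRange (proj₂ (∈-windowsXm⁻ l′∈))

  extreme-inRange : ∀ {v} → IsExtreme v → InRange n v
  extreme-inRange (inj₁ refl) = pos (ℕ.n<1+n m)
  extreme-inRange (inj₂ refl) = neg (ℕ.n<1+n m)

  neg-extreme : ∀ {v} → IsExtreme v → IsExtreme (- v)
  neg-extreme (inj₁ refl) = inj₂ refl
  neg-extreme (inj₂ refl) = inj₁ refl

  extreme≢-extreme : ∀ {v} → IsExtreme v → v ≢ - v
  extreme≢-extreme (inj₁ refl) ()
  extreme≢-extreme (inj₂ refl) ()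

  1≢extreme : ∀ {v} → IsExtreme v → 1ℤ ≢ v
  1≢extreme (inj₁ refl) ()
  1≢extreme (inj₂ refl) ()

  extremes∉ : ∀ {v l} → IsExtreme v → v ∉ l → - v ∉ l → N ∉ l × N̄ ∉ l
  extremes∉ (inj₁ refl) v∉ -v∉ = v∉ , -v∉
  extremes∉ (inj₂ refl) v∉ -v∉ = -v∉ , v∉

  insertion-inRange : ∀ {v l′ l} → IsExtreme v → Insertion v l′ l →
    (∀ {x} → x ∈ l′ → InRange m x) → ∀ {x} → x ∈ l → InRange n x
  insertion-inRange v-extreme i inRange x∈ with ∈-insertion⁻ i x∈
  ... | inj₁ refl = extreme-inRange v-extreme
  ... | inj₂ x∈′  = InRange-suc (inRange x∈′)

  ∈-extended⁻ : ∀ {l} → l ∈ extended → l ∈ windowsXn × inXList n l ≡ true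
  ∈-extended⁻ {l} l∈ with find (∈-concatMap⁻ extensions {xs = windowsXm} l∈)
  ... | l′ , l′∈ , l∈ext with ∈-windowsXm⁻ l′∈ | ∈-extensions⁻ l′ l∈ext
  ...   | length≡ , isX inRange signedUnique one∈ | v , v-extreme , i =
    ∈-allLists⁺ (signedRange n) n (trans (length-insertion i) (cong suc length≡))
      (∈-signedRange⁺ n ∘ insertion-inRange v-extreme i inRange) ,
    IsX⇒inXList n l (isX (insertion-inRange v-extreme i inRange) signedUnique′ (∈-insertion⁺ i one∈))
    where
    signedUnique′ : SignedUnique l
    signedUnique′ = signedUnique-insertion⁺ i signedUnique
      (extreme∉ v-extreme inRange) (extreme∉ (neg-extreme v-extreme) inRange) (extreme≢-extreme v-extreme)

  extreme∈⇒∈extended : ∀ {v l} → IsExtreme v → length l ≡ n → IsX n l → v ∈ l → l ∈ extended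
  extreme∈⇒∈extended {v} {l} v-extreme length≡ (isX inRange signedUnique one∈) v∈ with ∈⇒insertion v∈
  ... | l′ , i with signedUnique-insertion⁻ i signedUnique
  ...   | signedUnique′ , v∉ , -v∉ = ∈-concatMap⁺ extensions (lose l′∈windowsXm (∈-extensions⁺ v-extreme i))
    where
    inRange′ : ∀ {x} → x ∈ l′ → InRange m x
    inRange′ x∈ = let N∉ , N̄∉ = extremes∉ v-extreme v∉ -v∉ in
      InRange-pred (inRange (∈-insertion⁺ i x∈)) (λ { refl → N∉ x∈ }) (λ { refl → N̄∉ x∈ })
    one∈′ : 1ℤ ∈ l′
    one∈′ with ∈-insertion⁻ i one∈
    ... | inj₁ 1≡v = ⊥-elim (1≢extreme v-extreme 1≡v)
    ... | inj₂ 1∈  = 1∈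
    l′∈windowsXm : l′ ∈ windowsXm
    l′∈windowsXm = ∈-filter⁺ (λ l → inXList m l ≟ᵇ true)
      (∈-allLists⁺ (signedRange m) m (ℕ.suc-injective (trans (sym (length-insertion i)) length≡)) (∈-signedRange⁺ m ∘ inRange′))
      (IsX⇒inXList m l′ (isX inRange′ signedUnique′ one∈′))

  ∈-extended⁺ : ∀ {l} → l ∈ windowsXn → inXList n l ≡ true → l ∈ extended
  ∈-extended⁺ {l} l∈ inX with proj₁ (∈-allLists⁻ (signedRange n) n l∈) | inXList⇒IsX n l inX
  ... | length≡ | isX-l with ±top∈window m l length≡ isX-l
  ...   | inj₁ N∈ = extreme∈⇒∈extended (inj₁ refl) length≡ isX-l N∈
  ...   | inj₂ N̄∈ = extreme∈⇒∈extended (inj₂ refl) length≡ isX-l N̄∈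

  count-windowsXn : ∀ f → count (λ l → inXList n l ∧ f l) windowsXn ≡ count f extended
  count-windowsXn f = begin
    count (λ l → inXList n l ∧ f l) windowsXn           ≡⟨ length-filterᵇ _ windowsXn ⟨
    length (filterᵇ (λ l → inXList n l ∧ f l) windowsXn) ≡⟨ Unique-⊆-antisym⇒length≡
      (Unique.filter⁺ _ (allLists-unique (signedRange n) n (signedRange-unique n)))
      (Unique.filter⁺ _ extended-unique) ⊆extended ⊆windowsXn ⟩
    length (filterᵇ f extended)                          ≡⟨ length-filterᵇ f extended ⟩
    count f extended                                     ∎
    where
    open ≡-Reasoning
    ⊆extended : filterᵇ (λ l → inXList n l ∧ f l) windowsXn ⊆ filterᵇ f extended
    ⊆extended l∈ with ∈-filter⁻ (λ l → (inXList n l ∧ f l) ≟ᵇ true) {xs = windowsXn} l∈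
    ... | l∈Xn , inX∧f with ∧≡true⁻ inX∧f
    ...   | inX , fl = ∈-filter⁺ (λ l → f l ≟ᵇ true) (∈-extended⁺ l∈Xn inX) fl
    ⊆windowsXn : filterᵇ f extended ⊆ filterᵇ (λ l → inXList n l ∧ f l) windowsXn
    ⊆windowsXn l∈ with ∈-filter⁻ (λ l → f l ≟ᵇ true) {xs = extended} l∈
    ... | l∈ext , fl with ∈-extended⁻ l∈ext
    ...   | l∈Xn , inX = ∈-filter⁺ (λ l → (inXList n l ∧ f l) ≟ᵇ true) l∈Xn (∧≡true⁺ inX fl)

  -- Inserting N between the neighbours a, y of a padded window replaces the gap test a ≪ y by
  -- a ≪ N (as N ≪ y fails); gainN a y records whether this adds a big ascent. Likewise for N̄.
  gainN gainN̄ : ℤ → ℤ → Bool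
  gainN a y = (a ≪[ n ] N) ∧ not (a ≪[ n ] y)
  gainN̄ a y = (N̄ ≪[ n ] y) ∧ not (a ≪[ n ] y)

  gains : ℤ → List ℤ → List Bool
  gains a []      = gainN a 0ℤ ∷ gainN̄ a 0ℤ ∷ []
  gains a (x ∷ r) = gainN a x ∷ gainN̄ a x ∷ gains x r

  ascentsAfter : ℤ → List ℤ → ℕ
  ascentsAfter a l′ = ascMiddle n (a ∷ l′ ++ [ 0ℤ ])

  module _ {a y : ℤ} (a∈ : InRange₀ m a) (y∈ : InRange₀ m y) where

    ≪⇒≪N : (a ≪[ n ] y) ≡ true → (a ≪[ n ] N) ≡ true
    ≪⇒≪N a≪y with a ℤ.≟ M
    ≪⇒≪N a≪y | yes refl with trans (sym a≪y) (M≪-false {y} {n} y∈)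
    ... | ()
    ≪⇒≪N a≪y | no a≢M   = ≪N-true a∈ a≢M

    ≪⇒N̄≪ : (a ≪[ n ] y) ≡ true → (N̄ ≪[ n ] y) ≡ true
    ≪⇒N̄≪ a≪y with y ℤ.≟ M̄
    ≪⇒N̄≪ a≪y | yes refl with trans (sym a≪y) (≪M̄-false {a} {n} a∈)
    ... | ()
    ≪⇒N̄≪ a≪y | no y≢M̄   = N̄≪-true y∈ y≢M̄

    insertN-ascents : ∀ q → indicator (a ≪[ n ] N) ℕ.+ (indicator (N ≪[ n ] y) ℕ.+ q)
                          ≡ indicator (gainN a y) ℕ.+ (indicator (a ≪[ n ] y) ℕ.+ q)
    insertN-ascents q rewrite N≪-false y∈ with (a ≪[ n ] y) in a≪y
    ... | true rewrite ≪⇒≪N a≪y = refl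
    ... | false with a ≪[ n ] N
    ...   | true  = refl
    ...   | false = refl

    insertN̄-ascents : ∀ q → indicator (a ≪[ n ] N̄) ℕ.+ (indicator (N̄ ≪[ n ] y) ℕ.+ q)
                          ≡ indicator (gainN̄ a y) ℕ.+ (indicator (a ≪[ n ] y) ℕ.+ q)
    insertN̄-ascents q rewrite ≪N̄-false {a} with (a ≪[ n ] y) in a≪y
    ... | true rewrite ≪⇒N̄≪ a≪y = refl
    ... | false with N̄ ≪[ n ] y
    ...   | true  = refl
    ...   | false = refl

    no-gainN : indicator (not (gainN a y)) ≡ indicator (a ≪[ n ] y) ℕ.+ indicator (a == M)
    no-gainN with a ℤ.≟ M
    ... | yes refl rewrite M≪N-false | M≪-false {y} {n} y∈ = refl
    ... | no a≢M rewrite ≪N-true a∈ a≢M with (a ≪[ n ] y)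
    ...   | true  = refl
    ...   | false = refl

    no-gainN̄ : indicator (not (gainN̄ a y)) ≡ indicator (a ≪[ n ] y) ℕ.+ indicator (y == M̄)
    no-gainN̄ with y ℤ.≟ M̄
    ... | yes refl rewrite N̄≪M̄-false | ≪M̄-false {a} {n} a∈ = refl
    ... | no y≢M̄ rewrite N̄≪-true y∈ y≢M̄ with (a ≪[ n ] y)
    ...   | true  = refl
    ...   | false = refl

  ascents-extensions : ∀ a l′ → InRange₀ m a → (∀ {x} → x ∈ l′ → InRange m x) →
    map (ascentsAfter a) (extensions l′) ≡ map (λ d → indicator d ℕ.+ ascentsAfter a l′) (gains a l′)
  ascents-extensions a []      a∈ _       =
    cong₂ _∷_ (insertN-ascents a∈ origin 0) (cong₂ _∷_ (insertN̄-ascents a∈ origin 0) refl)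
  ascents-extensions a (x ∷ r) a∈ inRange =
    cong₂ _∷_ (insertN-ascents a∈ x∈ (ascentsAfter x r)) (cong₂ _∷_ (insertN̄-ascents a∈ x∈ (ascentsAfter x r)) (begin
      map (ascentsAfter a) (map (x ∷_) (extensions r))
        ≡⟨ List.map-∘ (extensions r) ⟨
      map ((indicator (a ≪[ n ] x) ℕ.+_) ∘ ascentsAfter x) (extensions r)
        ≡⟨ List.map-∘ (extensions r) ⟩
      map (indicator (a ≪[ n ] x) ℕ.+_) (map (ascentsAfter x) (extensions r))
        ≡⟨ cong (map (indicator (a ≪[ n ] x) ℕ.+_)) (ascents-extensions x r x∈ (inRange ∘ there)) ⟩
      map (indicator (a ≪[ n ] x) ℕ.+_) (map (λ d → indicator d ℕ.+ ascentsAfter x r) (gains x r))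
        ≡⟨ List.map-∘ (gains x r) ⟨
      map (λ d → indicator (a ≪[ n ] x) ℕ.+ (indicator d ℕ.+ ascentsAfter x r)) (gains x r)
        ≡⟨ List.map-cong (λ d → x∙yz≈y∙xz (indicator (a ≪[ n ] x)) (indicator d) _) (gains x r) ⟩
      map (λ d → indicator d ℕ.+ ascentsAfter a (x ∷ r)) (gains x r) ∎))
    where
    open ≡-Reasoning
    x∈ : InRange₀ m x
    x∈ = signed (inRange (here refl))

  count-no-gains : ∀ a l′ → InRange₀ m a → (∀ {x} → x ∈ l′ → InRange m x) →
    count not (gains a l′) ≡ (ascentsAfter a l′ ℕ.+ ascentsAfter a l′) ℕ.+ indicator (a == M)
                               ℕ.+ (count (_== M) l′ ℕ.+ count (_== M̄) l′)
  count-no-gains a []      a∈ _ rewrite no-gainN a∈ origin | no-gainN̄ a∈ origin =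
    base (indicator (a ≪[ n ] 0ℤ)) (indicator (a == M))
    where
    base : ∀ c e → (c ℕ.+ e) ℕ.+ ((c ℕ.+ 0) ℕ.+ 0) ≡ ((c ℕ.+ 0) ℕ.+ (c ℕ.+ 0)) ℕ.+ e ℕ.+ (0 ℕ.+ 0)
    base = ℕ-Solver.solve-∀
  count-no-gains a (x ∷ r) a∈ inRange
    rewrite no-gainN a∈ (signed (inRange (here refl))) | no-gainN̄ a∈ (signed (inRange (here refl)))
          | count-no-gains x r (signed (inRange (here refl))) (inRange ∘ there) =
    step (indicator (a ≪[ n ] x)) (indicator (a == M)) (indicator (x == M̄)) (ascentsAfter x r)
         (indicator (x == M)) (count (_== M) r) (count (_== M̄) r)
    where
    step : ∀ c e f p g s t → (c ℕ.+ e) ℕ.+ ((c ℕ.+ f) ℕ.+ ((p ℕ.+ p) ℕ.+ g ℕ.+ (s ℕ.+ t)))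
                           ≡ ((c ℕ.+ p) ℕ.+ (c ℕ.+ p)) ℕ.+ e ℕ.+ ((g ℕ.+ s) ℕ.+ (f ℕ.+ t))
    step = ℕ-Solver.solve-∀

  length-gains : ∀ a l′ → length (gains a l′) ≡ suc (length l′) ℕ.+ suc (length l′)
  length-gains a []      = refl
  length-gains a (x ∷ r) = cong (suc ∘ suc) (trans (length-gains x r) (sym (ℕ.+-suc (length r) (suc (length r)))))

  count-±M : ∀ {l′} → l′ ∈ windowsXm → count (_== M) l′ ℕ.+ count (_== M̄) l′ ≡ 1
  count-±M l′∈ with ∈-windowsXm⁻ l′∈
  ... | length≡ , isX-l′@(isX _ (u , ±-fresh) _) with ±top∈window k _ length≡ isX-l′
  ...   | inj₁ M∈ rewrite count-==-∈ _ u M∈ | count-==-∉ _ (±-fresh M∈) = refl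
  ...   | inj₂ M̄∈ rewrite count-==-∉ _ (±-fresh M̄∈) | count-==-∈ _ u M̄∈ = refl

  module _ {l′} (l′∈ : l′ ∈ windowsXm) where

    private
      inRange : ∀ {x} → x ∈ l′ → InRange m x
      inRange = IsX.inRange (proj₂ (∈-windowsXm⁻ l′∈))

    basc≡ascentsAfter0 : bascList m l′ ≡ ascentsAfter 0ℤ l′
    basc≡ascentsAfter0 = trans (bascList≡ascMiddle-pad l′ (All.tabulate inRange) (∈⇒≢[] (IsX.one∈ (proj₂ (∈-windowsXm⁻ l′∈)))))
      (ascMiddle-suc m (pad l′) (origin ∷ All-++⁺ (All.tabulate (signed ∘ inRange)) (origin ∷ [])))

    count-extensions≡count-gains : ∀ K →
      count (λ l → + bascList n l == K) (extensions l′) ≡ count (λ d → + (indicator d ℕ.+ ascentsAfter 0ℤ l′) == K) (gains 0ℤ l′)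
    count-extensions≡count-gains K = begin
      count (λ l → + bascList n l == K) (extensions l′)
        ≡⟨ count-map (λ v → + v == K) (bascList n) (extensions l′) ⟩
      count (λ v → + v == K) (map (bascList n) (extensions l′))
        ≡⟨ cong (count (λ v → + v == K)) (List.map-cong-local (All.tabulate extension-basc)) ⟩
      count (λ v → + v == K) (map (ascentsAfter 0ℤ) (extensions l′))
        ≡⟨ cong (count (λ v → + v == K)) (ascents-extensions 0ℤ l′ origin inRange) ⟩
      count (λ v → + v == K) (map (λ d → indicator d ℕ.+ ascentsAfter 0ℤ l′) (gains 0ℤ l′))
        ≡⟨ count-map (λ v → + v == K) (λ d → indicator d ℕ.+ ascentsAfter 0ℤ l′) (gains 0ℤ l′) ⟨
      count (λ d → + (indicator d ℕ.+ ascentsAfter 0ℤ l′) == K) (gains 0ℤ l′) ∎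
      where
      open ≡-Reasoning
      extension-basc : ∀ {l} → l ∈ extensions l′ → bascList n l ≡ ascentsAfter 0ℤ l
      extension-basc l∈ with ∈-extensions⁻ l′ l∈
      ... | v , v-extreme , i =
        bascList≡ascMiddle-pad _ (All.tabulate (insertion-inRange v-extreme i inRange)) (∈⇒≢[] (inserted∈ i))

    length-gains≡2n : length (gains 0ℤ l′) ≡ 2 ℕ.* n
    length-gains≡2n = trans (length-gains 0ℤ l′) (cong (λ i → suc i ℕ.+ suc i) (proj₁ (∈-windowsXm⁻ l′∈)))
      ⟨ trans ⟩ cong (n ℕ.+_) (sym (ℕ.+-identityʳ n))

    count-no-gains-window : count not (gains 0ℤ l′) ≡ suc (ascentsAfter 0ℤ l′ ℕ.+ ascentsAfter 0ℤ l′)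
    count-no-gains-window = trans (count-no-gains 0ℤ l′ origin inRange)
      (trans (cong (ascentsAfter 0ℤ l′ ℕ.+ ascentsAfter 0ℤ l′ ℕ.+ 0 ℕ.+_) (count-±M l′∈))
             (trans (ℕ.+-comm _ 1) (cong suc (ℕ.+-identityʳ _))))

    count-extensions : ∀ K →
      + count (λ l → + bascList n l == K) (extensions l′)
        ≡ (+ (2 ℕ.* n) - + 2 * K + 1ℤ) * + indicator (+ bascList m l′ == K - 1ℤ)
          + (+ 2 * K + 1ℤ) * + indicator (+ bascList m l′ == K)
    count-extensions K = begin
      + count (λ l → + bascList n l == K) (extensions l′)
        ≡⟨ cong +_ (count-extensions≡count-gains K) ⟩
      + count (λ d → + (indicator d ℕ.+ ascentsAfter 0ℤ l′) == K) (gains 0ℤ l′)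
        ≡⟨ count-shifted (ascentsAfter 0ℤ l′) (gains 0ℤ l′) K count-no-gains-window ⟩
      coefficients (length (gains 0ℤ l′)) (ascentsAfter 0ℤ l′)
        ≡⟨ cong₂ coefficients length-gains≡2n (sym basc≡ascentsAfter0) ⟩
      coefficients (2 ℕ.* n) (bascList m l′) ∎
      where
      open ≡-Reasoning
      coefficients : ℕ → ℕ → ℤ
      coefficients L p = (+ L - + 2 * K + 1ℤ) * + indicator (+ p == K - 1ℤ) + (+ 2 * K + 1ℤ) * + indicator (+ p == K)

  recurrence : ∀ K → + ψ n K ≡ (+ (2 ℕ.* n) - + 2 * K + 1ℤ) * + ψ m (K - 1ℤ) + (+ 2 * K + 1ℤ) * + ψ m K
  recurrence K = begin
    + ψ n K
      ≡⟨ cong +_ (trans (ψ≡count n K) (count-windowsXn (λ l → + bascList n l == K))) ⟩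
    + count (λ l → + bascList n l == K) (concatMap extensions windowsXm)
      ≡⟨ cong +_ (count-concatMap (λ l → + bascList n l == K) extensions windowsXm) ⟩
    + sum (map (count (λ l → + bascList n l == K) ∘ extensions) windowsXm)
      ≡⟨ sum-indicators _ (λ l′ → + bascList m l′ == K - 1ℤ) (λ l′ → + bascList m l′ == K)
           (+ (2 ℕ.* n) - + 2 * K + 1ℤ) (+ 2 * K + 1ℤ) windowsXm (λ l′∈ → count-extensions l′∈ K) ⟩
    (+ (2 ℕ.* n) - + 2 * K + 1ℤ) * + count (λ l′ → + bascList m l′ == K - 1ℤ) windowsXm
      + (+ 2 * K + 1ℤ) * + count (λ l′ → + bascList m l′ == K) windowsXm
      ≡⟨ cong₂ (λ u v → (+ (2 ℕ.* n) - + 2 * K + 1ℤ) * + u + (+ 2 * K + 1ℤ) * + v) (ψm≡count (K - 1ℤ)) (ψm≡count K) ⟨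
    (+ (2 ℕ.* n) - + 2 * K + 1ℤ) * + ψ m (K - 1ℤ) + (+ 2 * K + 1ℤ) * + ψ m K ∎
    where
    open ≡-Reasoning
    ψm≡count : ∀ K′ → ψ m K′ ≡ count (λ l′ → + bascList m l′ == K′) windowsXm
    ψm≡count K′ = trans (ψ≡count m K′) (sym (count-filterᵇ (inXList m) _ (allLists (signedRange m) m)))

proposition7p1 :
    (ψ 1 0ℤ ≡ 1)
    × (∀ (k : ℤ) → k ≢ 0ℤ → ψ 1 k ≡ 0)
    × (∀ (n : ℕ) → 2 ≤ n → ∀ (k : ℤ) →
         + ψ n k ≡ ((+ (2 Data.Nat.* n)) - (+ 2 * k) + 1ℤ) * (+ ψ (n ∸ 1) (k - 1ℤ))
                   + ((+ 2 * k) + 1ℤ) * (+ ψ (n ∸ 1) k))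
proposition7p1 = refl , ψ₁ , λ { (suc (suc k)) (s≤s (s≤s z≤n)) → Extension.recurrence k }
  where
  ψ₁ : ∀ K → K ≢ 0ℤ → ψ 1 K ≡ 0
  ψ₁ K K≢0 rewrite dec-false (0ℤ ℤ.≟ K) (K≢0 ∘ sym) = refl
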